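{- Let $\mathcal{F}$ be a CNF formula, let $\mathcal{R}=\mathcal{F}$, and for $\mathcal{W}\subseteq\mathcal{R}$ let $P(\mathcal{W})=\mathrm{SAT}\big(\bigwedge_{c\in\mathcal{R}\setminus\mathcal{W}}\neg c\big)$. Then $P$ is monotone, and every minimal subset $\mathcal{M}\subseteq\mathcal{R}$ for $P$ is a Minimal Correction (for Falsifiability) Subset of $\mathcal{F}$. (Hence computing an MCFS reduces to the MSMP problem.)
   Context: A CNF formula is a set of clauses; $\neg c$ for a clause $c$ is the conjunction of the complements of its literals. $\mathrm{SAT}(\varphi)$ is $1$ iff $\varphi$ is satisfiable. A predicate $P:2^{\mathcal{R}}\to\{0,1\}$ is monotone if $P(\mathcal{R}_0)$ and $\mathcal{R}_0\subseteq\mathcal{R}_1\subseteq\mathcal{R}$ imply $P(\mathcal{R}_1)$; $\mathcal{M}\subseteq\mathcal{R}$ is minimal for $P$ if $P(\mathcal{M})$ holds and $P(\mathcal{M}')$ fails for every $\mathcal{M}'\subsetneq\mathcal{M}$. The MSMP problem asks for a minimal set for a given monotone predicate. A set of clauses $\mathcal{U}$ is all-falsifiable if some truth assignment falsifies every clause of $\mathcal{U}$. $\mathcal{C}\subseteq\mathcal{F}$ is a Minimal Correction (for Falsifiability) Subset (MCFS) iff $\mathcal{F}\setminus\mathcal{C}$ is all-falsifiable and $\mathcal{F}\setminus\mathcal{C}'$ is not all-falsifiable for every $\mathcal{C}'\subsetneq\mathcal{C}$. -}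

module Defs where

open import Data.Nat using (ℕ)
open import Data.Bool using (Bool; true; false)
open import Data.Fin using (Fin)
open import Data.Fin.Subset using (Subset; _∈_; _∉_; _⊆_; _⊂_; ∁; _─_; ⊤)
open import Data.List using (List)
open import Data.List.Relation.Unary.All using (All)
open import Data.List.Relation.Unary.Any using (Any)
open import Data.Product using (Σ; _×_)
open import Relation.Binary.PropositionalEquality using (_≡_)
open import Relation.Nullary using (¬_)

-- Propositional variables are natural numbers.
-- A literal is a variable together with a polarity (true = positive).
record Literal : Set where
  constructor lit
  field
    var      : ℕ
    polarity : Bool

open Literal public

Clause : Set
Clause = List Literal

-- A CNF formula with m clauses, indexed by Fin m (a clause set; the
-- index set Fin m plays the role of F = R).
CNF : ℕ → Set
CNF m = Fin m → Clause

Assignment : Set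
Assignment = ℕ → Bool

LitTrue : Assignment → Literal → Set
LitTrue a l = a (var l) ≡ polarity l

ClauseSat : Assignment → Clause → Set
ClauseSat a c = Any (LitTrue a) c

NegClauseSat : Assignment → Clause → Set
NegClauseSat a c = All (λ l → ¬ LitTrue a l) c

SATNeg : {m : ℕ} → CNF m → Subset m → Set
SATNeg {m} F S = Σ Assignment (λ a → ∀ (i : Fin m) → i ∈ S → NegClauseSat a (F i))

AllFalsifiable : {m : ℕ} → CNF m → Subset m → Set
AllFalsifiable {m} F S =
  Σ Assignment (λ a → ∀ (i : Fin m) → i ∈ S → ¬ ClauseSat a (F i))

P : {m : ℕ} → CNF m → Subset m → Set
P F W = SATNeg F (⊤ ─ W)

Monotone : {m : ℕ} → (Subset m → Set) → Set
Monotone {m} Q = ∀ (R₀ R₁ : Subset m) → Q R₀ → R₀ ⊆ R₁ → Q R₁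

Minimal : {m : ℕ} → (Subset m → Set) → Subset m → Set
Minimal {m} Q M = Q M × (∀ (M' : Subset m) → M' ⊂ M → ¬ Q M')

MCFS : {m : ℕ} → CNF m → Subset m → Set
MCFS {m} F C =
  AllFalsifiable F (⊤ ─ C) ×
  (∀ (C' : Subset m) → C' ⊂ C → ¬ AllFalsifiable F (⊤ ─ C'))

-- P(W) says that the clauses outside W can be falsified simultaneously,
-- since an assignment satisfies ¬c exactly when it falsifies c.  So P(W)
-- is the predicate "F ∖ W is all-falsifiable", which is monotone because
-- growing W shrinks F ∖ W, and an MCFS is by definition a minimal set for
-- exactly that predicate.
module Submission where

open import Defs
open import Data.Nat using (ℕ)
open import Data.Fin using (Fin)
open import Data.Fin.Subset using (Subset; _∈_; _∉_; _⊆_; _─_; ⊤; inside; outside)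
open import Data.Fin.Subset.Properties using (p─q⊆p; x∈p∧x∉q⇒x∈p─q)
open import Data.List.Relation.Unary.All.Properties using (All¬⇒¬Any; ¬Any⇒All¬)
open import Data.Product using (_×_; _,_)
open import Data.Vec using (_∷_; here; there)
open import Function using (_∘_)
open import Function.Bundles using (_⇔_; mk⇔; Equivalence)
open import Relation.Nullary using (¬_)

x∈p─q⇒x∉q : ∀ {n} {x : Fin n} (p q : Subset n) → x ∈ p ─ q → x ∉ q
x∈p─q⇒x∉q (_ ∷ p) (outside ∷ q) (there x∈p─q) (there x∈q) = x∈p─q⇒x∉q p q x∈p─q x∈q
x∈p─q⇒x∉q (_ ∷ p) (inside  ∷ q) (there x∈p─q) (there x∈q) = x∈p─q⇒x∉q p q x∈p─q x∈q

p─-antitoneʳ : ∀ {n} (p : Subset n) {q r : Subset n} → q ⊆ r → p ─ r ⊆ p ─ q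
p─-antitoneʳ p {q} {r} q⊆r x∈p─r =
  x∈p∧x∉q⇒x∈p─q (p─q⊆p p r x∈p─r) (x∈p─q⇒x∉q p r x∈p─r ∘ q⊆r)

NegClauseSat⇔¬ClauseSat : ∀ a c → NegClauseSat a c ⇔ (¬ ClauseSat a c)
NegClauseSat⇔¬ClauseSat a c = mk⇔ All¬⇒¬Any (¬Any⇒All¬ c)

SATNeg⇔AllFalsifiable : ∀ {m} (F : CNF m) S → SATNeg F S ⇔ AllFalsifiable F S
SATNeg⇔AllFalsifiable F S = mk⇔
  (λ (a , neg) → a , λ i i∈S → Equivalence.to   (NegClauseSat⇔¬ClauseSat a (F i)) (neg i i∈S))
  (λ (a , fal) → a , λ i i∈S → Equivalence.from (NegClauseSat⇔¬ClauseSat a (F i)) (fal i i∈S))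

SATNeg-antitone : ∀ {m} (F : CNF m) {S T : Subset m} → S ⊆ T → SATNeg F T → SATNeg F S
SATNeg-antitone F S⊆T (a , neg) = a , λ i → neg i ∘ S⊆T

Minimal-resp-⇔ : ∀ {m} {Q Q′ : Subset m → Set} → (∀ W → Q W ⇔ Q′ W) →
                 ∀ M → Minimal Q M → Minimal Q′ M
Minimal-resp-⇔ Q⇔Q′ M (QM , below) =
  Equivalence.to (Q⇔Q′ M) QM , λ M′ M′⊂M → below M′ M′⊂M ∘ Equivalence.from (Q⇔Q′ M′)

proposition12 : (m : ℕ) → (F : CNF m) →
    Monotone (P F) × (∀ (M : Subset m) → Minimal (P F) M → MCFS F M)
proposition12 m F = P-monotone , Minimal-resp-⇔ (λ W → SATNeg⇔AllFalsifiable F (⊤ ─ W))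
  where
  P-monotone : Monotone (P F)
  P-monotone R₀ R₁ PR₀ R₀⊆R₁ = SATNeg-antitone F (p─-antitoneʳ ⊤ R₀⊆R₁) PR₀
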